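{- Let $U=\{u_1,\dots,u_{2^m}\}\subseteq\mathbb F_2^n\setminus\{0\}$ be a set of $2^m$ distinct nonzero vectors, let $B:\mathbb F_2^n\to\mathbb F_2^m$ be a uniformly random linear map, fix $y\in\mathbb F_2^m$, and let $Z_y:=|\{i:Bu_i=y\}|$. Then for every integer $a\ge1$, \[ \Pr[Z_y>2^a-2]\le \gamma^{ -1}2^{ -a^2},\qquad \gamma:=\prod_{j=1}^\infty(1-2^{ -j}). \]
   Context: A uniformly random linear map is chosen uniformly among all $\mathbb F_2$-linear maps $\mathbb F_2^n\to\mathbb F_2^m$. -}

module Defs where

open import Data.Bool using (Bool; true; false; _xor_; _∧_)
open import Data.Bool.Properties using () renaming (_≟_ to _≟ᵇ_)
open import Data.Nat using (ℕ; zero; suc; _^_; _∸_; _<_; _<?_)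
open import Data.Fin using (Fin)
open import Data.Vec using (Vec; []; _∷_; tabulate; foldr; zipWith; replicate; lookup)
open import Data.Vec.Properties using (≡-dec)
open import Data.List using (List; []; _∷_; length; filter; concatMap; map; allFin)
open import Data.Rational using (ℚ; 1ℚ; ½; _*_; _-_)

-- The field F₂ is modelled by Bool (xor = addition, ∧ = multiplication).
F₂ : Set
F₂ = Bool

F₂^ : ℕ → Set
F₂^ n = Vec F₂ n

zero-vec : (n : ℕ) → F₂^ n
zero-vec n = replicate n false

-- A linear map F₂^n → F₂^m, represented (bijectively) by its m × n matrix
-- (list of m rows, each in F₂^n).
LinMap : ℕ → ℕ → Set
LinMap n m = Vec (F₂^ n) m

dot : {n : ℕ} → F₂^ n → F₂^ n → F₂
dot u v = foldr _ _xor_ false (zipWith _∧_ u v)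

apply : {n m : ℕ} → LinMap n m → F₂^ n → F₂^ m
apply B u = Data.Vec.map (λ row → dot row u) B

allVecsOf : {A : Set} → List A → (k : ℕ) → List (Vec A k)
allVecsOf xs zero = [] ∷ []
allVecsOf xs (suc k) = concatMap (λ x → map (x ∷_) (allVecsOf xs k)) xs

-- the sample space: all linear maps F₂^n → F₂^m (each exactly once; 2^(m n) of them)
allLinMaps : (n m : ℕ) → List (LinMap n m)
allLinMaps n m = allVecsOf (allVecsOf (false ∷ true ∷ []) n) m

Z : {n m : ℕ} → (Fin (2 ^ m) → F₂^ n) → F₂^ m → LinMap n m → ℕ
Z {n} {m} u y B = length (filter (λ i → ≡-dec _≟ᵇ_ (apply B (u i)) y) (allFin (2 ^ m)))

countBad : {n m : ℕ} → (Fin (2 ^ m) → F₂^ n) → F₂^ m → ℕ → ℕ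
countBad {n} {m} u y a =
  length (filter (λ B → (2 ^ a ∸ 2) <? Z u y B) (allLinMaps n m))

total : ℕ → ℕ → ℕ
total n m = length (allLinMaps n m)

half^ : ℕ → ℚ
half^ zero = 1ℚ
half^ (suc j) = ½ * half^ j

-- partial product P_N = ∏_{j=1}^{N} (1 - 2^{-j});  γ = lim_N P_N = inf_N P_N
partialγ : ℕ → ℚ
partialγ zero = 1ℚ
partialγ (suc N) = partialγ N * (1ℚ - half^ (suc N))

{-# OPTIONS --safe #-}
-- Call a tuple of indices i₁ … i_t fresh for B if B u_{i_j} = y for every j and each u_{i_j} lies
-- outside the span of u_{i_1}, …, u_{i_{j-1}}.  The span of j vectors contains at most 2^j − 1 of the
-- distinct nonzero u_i, so if Z_y(B) ≥ 2^a − 1 there are at least ∏_{j<a} (2^a − 2^j) = 2^{a²} P_a fresh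
-- a-tuples, where P_a = ∏_{j=1}^{a} (1 − 2^{-j}).  Conversely, a vector outside the span of p₁ … p_j is
-- separated from them by a linear functional; translating the rows of B by it shows that exactly a 2^{-m}
-- fraction of the maps sending p₁ … p_j to y also send that vector to y.  So the expected number of fresh
-- a-tuples is at most (2^m)^a · 2^{-ma} = 1, and Markov's inequality gives Pr[Z_y > 2^a − 2] · 2^{a²} P_a ≤ 1.
module Submission where

open import Defs

module Counting where

  open import Algebra.Bundles using (CommutativeMonoid; CommutativeRing)
  open import Data.Bool using (Bool; true; false; not; _∧_; _xor_)
  open import Data.Bool.ListAction using (all)
  open import Data.Bool.Properties
    using ( ∧-distribʳ-xor; ∧-distribˡ-xor; xor-identityʳ; xor-comm; true-xor; xor-assoc; xor-same
          ; xor-∧-commutativeRing; ∧-commutativeMonoid)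
    renaming (_≟_ to _≟ᵇ_)
  open import Data.Empty using (⊥-elim)
  open import Data.Fin using (Fin; zero; suc)
  open import Data.Fin.Properties using (0≢1+n; suc-injective)
  open import Data.List using (List; []; _∷_; _++_; length; map; concatMap; filter; allFin)
  open import Data.List.Membership.Propositional using (_∈_; _∉_)
  open import Data.List.Membership.Propositional.Properties using (∈-++⁺ˡ; ∈-++⁺ʳ; ∈-map⁺)
  open import Data.List.Properties using (length-++; length-map; map-tabulate; length-tabulate)
  open import Data.List.Relation.Unary.All as All using (All; []; _∷_)
  open import Data.List.Relation.Unary.Any using (here; there)
  open import Data.Nat using (ℕ; zero; suc; _+_; _*_; _^_; _∸_; _≤_; _<_; _<?_; z≤n; s≤s)
  open import Data.Nat.Properties hiding (0≢1+n; suc-injective)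
  open import Data.Nat.Tactic.RingSolver using (solve-∀)
  open import Data.Product using (∃-syntax; _×_; _,_)
  open import Data.Sum using (_⊎_; inj₁; inj₂; fromInj₂)
  open import Data.Vec using ([]; _∷_; zipWith)
  open import Data.Vec.Properties using (≡-dec)
  open import Function using (_∘_)
  open import Function.Definitions using (Injective)
  open import Relation.Binary.Definitions using (DecidableEquality)
  open import Relation.Binary.PropositionalEquality
  open import Relation.Nullary using (does; Dec; yes; no)
  open import Relation.Nullary.Decidable using (dec-true; dec-false)
  open import Relation.Unary using (Decidable)

  open import Algebra.Properties.CommutativeSemigroup
    (CommutativeRing.+-commutativeSemigroup xor-∧-commutativeRing)
    using () renaming (interchange to xor-interchange)
  open import Algebra.Properties.CommutativeSemigroup (CommutativeMonoid.commutativeSemigroup ∧-commutativeMonoid)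
    using () renaming (interchange to ∧-interchange)
  open import Algebra.Properties.CommutativeSemigroup *-commutativeSemigroup
    using () renaming (interchange to *-interchange)
  open import Algebra.Properties.CommutativeSemigroup +-commutativeSemigroup
    using () renaming (interchange to +-interchange)

  𝟙[_] : Bool → ℕ
  𝟙[ true ] = 1
  𝟙[ false ] = 0

  𝟙-∧ : ∀ a b → 𝟙[ a ∧ b ] ≡ 𝟙[ a ] * 𝟙[ b ]
  𝟙-∧ true  b = sym (*-identityˡ 𝟙[ b ])
  𝟙-∧ false b = refl

  𝟙≤1 : ∀ b → 𝟙[ b ] ≤ 1
  𝟙≤1 true  = s≤s z≤n
  𝟙≤1 false = z≤n

  𝟙-split-≟ : ∀ b c a → 𝟙[ does (b ≟ᵇ c) ∧ a ] + 𝟙[ does (not b ≟ᵇ c) ∧ a ] ≡ 𝟙[ a ]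
  𝟙-split-≟ true  true  a = +-identityʳ 𝟙[ a ]
  𝟙-split-≟ true  false a = refl
  𝟙-split-≟ false true  a = refl
  𝟙-split-≟ false false a = +-identityʳ 𝟙[ a ]

  𝟙-≤-split : ∀ s e → 𝟙[ e ] ≤ 𝟙[ not s ∧ e ] + 𝟙[ s ]
  𝟙-≤-split true  e = 𝟙≤1 e
  𝟙-≤-split false e = m≤m+n 𝟙[ e ] 0

  𝟙-rearrange : ∀ g f e x → 𝟙[ g ] * (𝟙[ f ∧ e ] * x) ≡ 𝟙[ f ] * (𝟙[ e ∧ g ] * x)
  𝟙-rearrange g f e x = begin
    𝟙[ g ] * (𝟙[ f ∧ e ] * x)         ≡⟨ cong (λ k → 𝟙[ g ] * (k * x)) (𝟙-∧ f e) ⟩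
    𝟙[ g ] * (𝟙[ f ] * 𝟙[ e ] * x)    ≡⟨ commute 𝟙[ g ] 𝟙[ f ] 𝟙[ e ] x ⟩
    𝟙[ f ] * (𝟙[ e ] * 𝟙[ g ] * x)    ≡⟨ cong (λ k → 𝟙[ f ] * (k * x)) (sym (𝟙-∧ e g)) ⟩
    𝟙[ f ] * (𝟙[ e ∧ g ] * x)         ∎
    where
    open ≡-Reasoning
    commute : ∀ a b c d → a * (b * c * d) ≡ b * (c * a * d)
    commute = solve-∀

  ∑ : {A : Set} → List A → (A → ℕ) → ℕ
  ∑ []       f = 0
  ∑ (x ∷ xs) f = f x + ∑ xs f

  syntax ∑ xs (λ x → e) = ∑[ x ∈ xs ] e

  module _ {A : Set} where

    ∑-cong : ∀ (xs : List A) {f g : A → ℕ} → (∀ x → f x ≡ g x) → ∑ xs f ≡ ∑ xs g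
    ∑-cong []       f≗g = refl
    ∑-cong (x ∷ xs) f≗g = cong₂ _+_ (f≗g x) (∑-cong xs f≗g)

    ∑-mono-≤ : ∀ (xs : List A) {f g : A → ℕ} → (∀ x → f x ≤ g x) → ∑ xs f ≤ ∑ xs g
    ∑-mono-≤ []       f≤g = z≤n
    ∑-mono-≤ (x ∷ xs) f≤g = +-mono-≤ (f≤g x) (∑-mono-≤ xs f≤g)

    ∑-distrib-+ : ∀ (xs : List A) f g → ∑[ x ∈ xs ] (f x + g x) ≡ ∑ xs f + ∑ xs g
    ∑-distrib-+ []       f g = refl
    ∑-distrib-+ (x ∷ xs) f g = begin
      f x + g x + ∑[ x ∈ xs ] (f x + g x) ≡⟨ cong (f x + g x +_) (∑-distrib-+ xs f g) ⟩
      f x + g x + (∑ xs f + ∑ xs g)       ≡⟨ +-interchange (f x) (g x) (∑ xs f) (∑ xs g) ⟩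
      f x + ∑ xs f + (g x + ∑ xs g)       ∎
      where open ≡-Reasoning

    *-distribˡ-∑ : ∀ c (xs : List A) f → c * ∑ xs f ≡ ∑[ x ∈ xs ] (c * f x)
    *-distribˡ-∑ c []       f = *-zeroʳ c
    *-distribˡ-∑ c (x ∷ xs) f = trans (*-distribˡ-+ c (f x) (∑ xs f)) (cong (c * f x +_) (*-distribˡ-∑ c xs f))

    *-distribʳ-∑ : ∀ c (xs : List A) f → ∑ xs f * c ≡ ∑[ x ∈ xs ] (f x * c)
    *-distribʳ-∑ c xs f = begin
      ∑ xs f * c              ≡⟨ *-comm (∑ xs f) c ⟩
      c * ∑ xs f              ≡⟨ *-distribˡ-∑ c xs f ⟩
      ∑[ x ∈ xs ] (c * f x)   ≡⟨ ∑-cong xs (λ x → *-comm c (f x)) ⟩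
      ∑[ x ∈ xs ] (f x * c)   ∎
      where open ≡-Reasoning

    ∑-const : ∀ (xs : List A) c → ∑[ x ∈ xs ] c ≡ length xs * c
    ∑-const []       c = refl
    ∑-const (x ∷ xs) c = cong (c +_) (∑-const xs c)

    ∑-++ : ∀ (xs ys : List A) f → ∑ (xs ++ ys) f ≡ ∑ xs f + ∑ ys f
    ∑-++ []       ys f = refl
    ∑-++ (x ∷ xs) ys f = trans (cong (f x +_) (∑-++ xs ys f)) (sym (+-assoc (f x) (∑ xs f) (∑ ys f)))

    ∑-map : ∀ {B : Set} (h : B → A) (xs : List B) f → ∑ (map h xs) f ≡ ∑[ x ∈ xs ] f (h x)
    ∑-map h []       f = refl
    ∑-map h (x ∷ xs) f = cong (f (h x) +_) (∑-map h xs f)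

    ∑-concatMap : ∀ {B : Set} (h : B → List A) (xs : List B) f →
                  ∑ (concatMap h xs) f ≡ ∑[ x ∈ xs ] ∑ (h x) f
    ∑-concatMap h []       f = refl
    ∑-concatMap h (x ∷ xs) f = trans (∑-++ (h x) (concatMap h xs) f) (cong (∑ (h x) f +_) (∑-concatMap h xs f))

    ∑-comm : ∀ {B : Set} (xs : List A) (ys : List B) (f : A → B → ℕ) →
             ∑[ x ∈ xs ] ∑[ y ∈ ys ] f x y ≡ ∑[ y ∈ ys ] ∑[ x ∈ xs ] f x y
    ∑-comm xs []       f = trans (∑-const xs 0) (*-zeroʳ (length xs))
    ∑-comm xs (y ∷ ys) f = trans (∑-distrib-+ xs (λ x → f x y) (λ x → ∑[ y ∈ ys ] f x y))
                                 (cong (∑[ x ∈ xs ] f x y +_) (∑-comm xs ys f))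

    length-filter≡∑ : ∀ {P : A → Set} (P? : Decidable P) xs →
                      length (filter P? xs) ≡ ∑[ x ∈ xs ] 𝟙[ does (P? x) ]
    length-filter≡∑ P? []       = refl
    length-filter≡∑ P? (x ∷ xs) with does (P? x)
    ... | true  = cong suc (length-filter≡∑ P? xs)
    ... | false = length-filter≡∑ P? xs

  ∑-allFin-suc : ∀ N (f : Fin (suc N) → ℕ) → ∑ (allFin (suc N)) f ≡ f zero + ∑[ i ∈ allFin N ] f (suc i)
  ∑-allFin-suc N f =
    cong (f zero +_) (trans (cong (λ is → ∑ is f) (sym (map-tabulate (λ i → i) suc))) (∑-map suc (allFin N) f))

  module _ {A : Set} (_≟_ : DecidableEquality A) where

    open import Data.List.Membership.DecPropositional _≟_ using (_∈?_)

    count : ∀ {N} → (Fin N → A) → A → ℕ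
    count {N} f x = ∑[ i ∈ allFin N ] 𝟙[ does (f i ≟ x) ]

    count-missing : ∀ N (f : Fin N → A) x → (∀ i → f i ≢ x) → count f x ≡ 0
    count-missing zero    f x f≢x = refl
    count-missing (suc N) f x f≢x = begin
      count f x                            ≡⟨ ∑-allFin-suc N _ ⟩
      𝟙[ does (f zero ≟ x) ] + count (f ∘ suc) x
        ≡⟨ cong₂ _+_ (cong 𝟙[_] (dec-false (f zero ≟ x) (f≢x zero))) (count-missing N (f ∘ suc) x (f≢x ∘ suc)) ⟩
      0 ∎
      where open ≡-Reasoning

    count-injective : ∀ N (f : Fin N → A) x → Injective _≡_ _≡_ f → count f x ≤ 1
    count-injective zero    f x inj = z≤n
    count-injective (suc N) f x inj = begin
      count f x                                   ≡⟨ ∑-allFin-suc N _ ⟩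
      𝟙[ does (f zero ≟ x) ] + count (f ∘ suc) x ≤⟨ head+tail≤1 (f zero ≟ x) ⟩
      1                                           ∎
      where
      open ≤-Reasoning
      head+tail≤1 : (d : Dec (f zero ≡ x)) → 𝟙[ does d ] + count (f ∘ suc) x ≤ 1
      head+tail≤1 (yes f0≡x) = ≤-reflexive (cong suc (count-missing N (f ∘ suc) x
                                 (λ i fi≡x → 0≢1+n (sym (inj (trans fi≡x (sym f0≡x)))))))
      head+tail≤1 (no _)     = count-injective N (f ∘ suc) x (suc-injective ∘ inj)

    ∈⇒1≤∑≟ : ∀ {v xs} → v ∈ xs → 1 ≤ ∑[ x ∈ xs ] 𝟙[ does (v ≟ x) ]
    ∈⇒1≤∑≟ {v} {x ∷ xs} (here v≡x) rewrite dec-true (v ≟ x) v≡x = s≤s z≤n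
    ∈⇒1≤∑≟ {v} {x ∷ xs} (there v∈xs) = m≤n⇒m≤o+n 𝟙[ does (v ≟ x) ] (∈⇒1≤∑≟ v∈xs)

    𝟙-∈?≤∑≟ : ∀ v xs → 𝟙[ does (v ∈? xs) ] ≤ ∑[ x ∈ xs ] 𝟙[ does (v ≟ x) ]
    𝟙-∈?≤∑≟ v xs with v ∈? xs
    ... | yes v∈xs = ∈⇒1≤∑≟ v∈xs
    ... | no  _    = z≤n

    count-∈?-≤ : ∀ N (f : Fin N → A) z xs → Injective _≡_ _≡_ f → (∀ i → f i ≢ z) →
                 ∑[ i ∈ allFin N ] 𝟙[ does (f i ∈? z ∷ xs) ] ≤ length xs
    count-∈?-≤ N f z xs inj f≢z = begin
      ∑[ i ∈ allFin N ] 𝟙[ does (f i ∈? z ∷ xs) ]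
        ≤⟨ ∑-mono-≤ (allFin N) (λ i → 𝟙-∈?≤∑≟ (f i) (z ∷ xs)) ⟩
      ∑[ i ∈ allFin N ] ∑[ x ∈ z ∷ xs ] 𝟙[ does (f i ≟ x) ]
        ≡⟨ ∑-comm (allFin N) (z ∷ xs) _ ⟩
      count f z + ∑[ x ∈ xs ] count f x
        ≡⟨ cong (_+ ∑[ x ∈ xs ] count f x) (count-missing N f z f≢z) ⟩
      ∑[ x ∈ xs ] count f x
        ≤⟨ ∑-mono-≤ xs (λ x → count-injective N f x inj) ⟩
      ∑[ x ∈ xs ] 1
        ≡⟨ ∑-const xs 1 ⟩
      length xs * 1
        ≡⟨ *-identityʳ (length xs) ⟩
      length xs ∎
      where open ≤-Reasoning

  -- Vectors over F₂, spans and separating functionals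

  _≟ᵥ_ : ∀ {n} → DecidableEquality (F₂^ n)
  _≟ᵥ_ = ≡-dec _≟ᵇ_

  infixl 6 _⊕_
  _⊕_ : ∀ {n} → F₂^ n → F₂^ n → F₂^ n
  _⊕_ = zipWith _xor_

  p⊕[p⊕v]≡v : ∀ {n} (p v : F₂^ n) → p ⊕ (p ⊕ v) ≡ v
  p⊕[p⊕v]≡v []      []      = refl
  p⊕[p⊕v]≡v (p ∷ q) (v ∷ w) =
    cong₂ _∷_ (trans (sym (xor-assoc p p v)) (cong (_xor v) (xor-same p))) (p⊕[p⊕v]≡v q w)

  dot-zeroˡ : ∀ {n} (v : F₂^ n) → dot (zero-vec n) v ≡ false
  dot-zeroˡ []      = refl
  dot-zeroˡ (_ ∷ v) = dot-zeroˡ v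

  dot-distribʳ-⊕ : ∀ {n} (r s v : F₂^ n) → dot (r ⊕ s) v ≡ dot r v xor dot s v
  dot-distribʳ-⊕ []      []      []      = refl
  dot-distribʳ-⊕ (a ∷ r) (b ∷ s) (c ∷ v) = begin
    ((a xor b) ∧ c) xor dot (r ⊕ s) v            ≡⟨ cong₂ _xor_ (∧-distribʳ-xor c a b) (dot-distribʳ-⊕ r s v) ⟩
    ((a ∧ c) xor (b ∧ c)) xor (dot r v xor dot s v) ≡⟨ xor-interchange (a ∧ c) (b ∧ c) (dot r v) (dot s v) ⟩
    ((a ∧ c) xor dot r v) xor ((b ∧ c) xor dot s v) ∎
    where open ≡-Reasoning

  dot-distribˡ-⊕ : ∀ {n} (r v w : F₂^ n) → dot r (v ⊕ w) ≡ dot r v xor dot r w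
  dot-distribˡ-⊕ []      []      []      = refl
  dot-distribˡ-⊕ (a ∷ r) (b ∷ v) (c ∷ w) = begin
    (a ∧ (b xor c)) xor dot r (v ⊕ w)               ≡⟨ cong₂ _xor_ (∧-distribˡ-xor a b c) (dot-distribˡ-⊕ r v w) ⟩
    ((a ∧ b) xor (a ∧ c)) xor (dot r v xor dot r w) ≡⟨ xor-interchange (a ∧ b) (a ∧ c) (dot r v) (dot r w) ⟩
    ((a ∧ b) xor dot r v) xor ((a ∧ c) xor dot r w) ∎
    where open ≡-Reasoning

  zero-or-detected : ∀ {n} (v : F₂^ n) → v ≡ zero-vec n ⊎ ∃[ r ] dot r v ≡ true
  zero-or-detected []          = inj₁ refl
  zero-or-detected (true ∷ v)  = inj₂ (true ∷ zero-vec _ , cong (true xor_) (dot-zeroˡ v))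
  zero-or-detected (false ∷ v) with zero-or-detected v
  ... | inj₁ v≡0       = inj₁ (cong (false ∷_) v≡0)
  ... | inj₂ (r , rv)  = inj₂ (false ∷ r , rv)

  dot-via-⊕ : ∀ {n} (r p v : F₂^ n) → dot r v ≡ dot r p xor dot r (p ⊕ v)
  dot-via-⊕ r p v = trans (cong (dot r) (sym (p⊕[p⊕v]≡v p v))) (dot-distribˡ-⊕ r p (p ⊕ v))

  Annihilates : ∀ {n} → F₂^ n → List (F₂^ n) → Set
  Annihilates r ps = All (λ p → dot r p ≡ false) ps

  Separated : ∀ {n} → List (F₂^ n) → F₂^ n → Set
  Separated ps v = ∃[ r ] Annihilates r ps × dot r v ≡ true

  annihilates-⊕ : ∀ {n} (r s : F₂^ n) {ps} → Annihilates r ps → Annihilates s ps → Annihilates (r ⊕ s) ps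
  annihilates-⊕ r s r⊥ps s⊥ps =
    All.zipWith (λ {p} (rp , sp) → trans (dot-distribʳ-⊕ r s p) (cong₂ _xor_ rp sp)) (r⊥ps , s⊥ps)

  module _ {n : ℕ} where

    span : List (F₂^ n) → List (F₂^ n)
    nonemptySubsetSums : List (F₂^ n) → List (F₂^ n)

    span ps = zero-vec n ∷ nonemptySubsetSums ps

    nonemptySubsetSums []       = []
    nonemptySubsetSums (p ∷ ps) = nonemptySubsetSums ps ++ map (p ⊕_) (span ps)

    length-span : ∀ ps → length (span ps) ≡ 2 ^ length ps
    length-span []       = refl
    length-span (p ∷ ps) = begin
      suc (length (nonemptySubsetSums ps ++ map (p ⊕_) (span ps)))
        ≡⟨ cong suc (length-++ (nonemptySubsetSums ps)) ⟩
      length (span ps) + length (map (p ⊕_) (span ps))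
        ≡⟨ cong (length (span ps) +_) (length-map (p ⊕_) (span ps)) ⟩
      length (span ps) + length (span ps)
        ≡⟨ cong (λ k → k + k) (length-span ps) ⟩
      2 ^ length ps + 2 ^ length ps
        ≡⟨ cong (2 ^ length ps +_) (sym (+-identityʳ (2 ^ length ps))) ⟩
      2 ^ length (p ∷ ps) ∎
      where open ≡-Reasoning

    span-∷⁺ : ∀ p ps {v} → v ∈ span ps → v ∈ span (p ∷ ps)
    span-∷⁺ p ps (here v≡0) = here v≡0
    span-∷⁺ p ps (there v∈) = there (∈-++⁺ˡ v∈)

    ⊕-span-∷⁺ : ∀ p ps {v} → v ∈ span ps → p ⊕ v ∈ span (p ∷ ps)
    ⊕-span-∷⁺ p ps v∈ = there (∈-++⁺ʳ (nonemptySubsetSums ps) (∈-map⁺ (p ⊕_) v∈))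

    -- A functional separating p ⊕ v from ps separates v from p ∷ ps, either by itself or after adding r.
    separated-∷ : ∀ {p v : F₂^ n} {ps} r → Annihilates r ps → dot r v ≡ true → dot r p ≡ true →
                  Separated ps (p ⊕ v) → Separated (p ∷ ps) v
    separated-∷ {p} {v} r r⊥ps rv rp (r′ , r′⊥ps , r′[p⊕v]) with dot r′ p in r′p
    ... | false = r′ , r′p ∷ r′⊥ps , trans (dot-via-⊕ r′ p v) (cong₂ _xor_ r′p r′[p⊕v])
    ... | true  = r ⊕ r′ , [r⊕r′]p ∷ annihilates-⊕ r r′ r⊥ps r′⊥ps , [r⊕r′]v
      where
      [r⊕r′]p : dot (r ⊕ r′) p ≡ false
      [r⊕r′]p = trans (dot-distribʳ-⊕ r r′ p) (cong₂ _xor_ rp r′p)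
      [r⊕r′]v : dot (r ⊕ r′) v ≡ true
      [r⊕r′]v = begin
        dot (r ⊕ r′) v                         ≡⟨ dot-distribʳ-⊕ r r′ v ⟩
        dot r v xor dot r′ v                   ≡⟨ cong (dot r v xor_) (dot-via-⊕ r′ p v) ⟩
        dot r v xor (dot r′ p xor dot r′ (p ⊕ v)) ≡⟨ cong₂ (λ a b → a xor (b xor dot r′ (p ⊕ v))) rv r′p ⟩
        true xor (true xor dot r′ (p ⊕ v))      ≡⟨ cong (λ a → true xor (true xor a)) r′[p⊕v] ⟩
        true                                   ∎
        where open ≡-Reasoning

    spanned-or-separated : ∀ ps v → v ∈ span ps ⊎ Separated ps v
    spanned-or-separated [] v with zero-or-detected v
    ... | inj₁ v≡0      = inj₁ (here v≡0)
    ... | inj₂ (r , rv) = inj₂ (r , [] , rv)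
    spanned-or-separated (p ∷ ps) v with spanned-or-separated ps v
    ... | inj₁ v∈span = inj₁ (span-∷⁺ p ps v∈span)
    ... | inj₂ (r , r⊥ps , rv) with dot r p in rp
    ...   | false = inj₂ (r , rp ∷ r⊥ps , rv)
    ...   | true with spanned-or-separated ps (p ⊕ v)
    ...     | inj₁ p⊕v∈span = inj₁ (subst (_∈ span (p ∷ ps)) (p⊕[p⊕v]≡v p v) (⊕-span-∷⁺ p ps p⊕v∈span))
    ...     | inj₂ p⊕v-sep = inj₂ (separated-∷ r r⊥ps rv rp p⊕v-sep)

  -- Counting linear maps with prescribed values

  bits : List F₂
  bits = false ∷ true ∷ []

  vectors : (n : ℕ) → List (F₂^ n)
  vectors = allVecsOf bits

  ∑-allVecsOf-suc : ∀ {A : Set} (xs : List A) k f →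
                    ∑ (allVecsOf xs (suc k)) f ≡ ∑[ x ∈ xs ] ∑[ v ∈ allVecsOf xs k ] f (x ∷ v)
  ∑-allVecsOf-suc xs k f = trans (∑-concatMap _ xs f) (∑-cong xs (λ x → ∑-map (x ∷_) (allVecsOf xs k) f))

  ∑-bits-translate : ∀ b (g : F₂ → ℕ) → ∑[ c ∈ bits ] g (c xor b) ≡ ∑ bits g
  ∑-bits-translate false g = refl
  ∑-bits-translate true  g = begin
    g true + (g false + 0) ≡⟨ cong (g true +_) (+-identityʳ (g false)) ⟩
    g true + g false       ≡⟨ +-comm (g true) (g false) ⟩
    g false + g true       ≡⟨ cong (g false +_) (sym (+-identityʳ (g true))) ⟩
    g false + (g true + 0) ∎
    where open ≡-Reasoning

  ∑-vectors-translate : ∀ {n} (t : F₂^ n) (f : F₂^ n → ℕ) → ∑[ r ∈ vectors n ] f (r ⊕ t) ≡ ∑ (vectors n) f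
  ∑-vectors-translate []              f = refl
  ∑-vectors-translate {suc n} (b ∷ t) f = begin
    ∑[ r ∈ vectors (suc n) ] f (r ⊕ (b ∷ t))
      ≡⟨ ∑-allVecsOf-suc _ n _ ⟩
    ∑[ c ∈ bits ] ∑[ r ∈ vectors n ] f ((c xor b) ∷ (r ⊕ t))
      ≡⟨ ∑-cong bits (λ c → ∑-vectors-translate t (λ r → f ((c xor b) ∷ r))) ⟩
    ∑[ c ∈ bits ] ∑[ r ∈ vectors n ] f ((c xor b) ∷ r)
      ≡⟨ ∑-bits-translate b (λ c → ∑[ r ∈ vectors n ] f (c ∷ r)) ⟩
    ∑[ c ∈ bits ] ∑[ r ∈ vectors n ] f (c ∷ r)
      ≡⟨ sym (∑-allVecsOf-suc _ n f) ⟩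
    ∑ (vectors (suc n)) f ∎
    where open ≡-Reasoning

  rowSolves : ∀ {n} → F₂^ n → F₂ → List (F₂^ n) → Bool
  rowSolves r c ps = all (λ p → does (dot r p ≟ᵇ c)) ps

  rowCount : ∀ {n} → F₂ → List (F₂^ n) → ℕ
  rowCount {n} c ps = ∑[ r ∈ vectors n ] 𝟙[ rowSolves r c ps ]

  rowSolves-⊕ : ∀ {n} (r r₀ : F₂^ n) c {ps} → Annihilates r₀ ps → rowSolves (r ⊕ r₀) c ps ≡ rowSolves r c ps
  rowSolves-⊕ r r₀ c []                     = refl
  rowSolves-⊕ r r₀ c {p ∷ ps} (r₀p ∷ r₀⊥ps) =
    cong₂ (λ b a → does (b ≟ᵇ c) ∧ a) [r⊕r₀]p (rowSolves-⊕ r r₀ c r₀⊥ps)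
    where
    [r⊕r₀]p : dot (r ⊕ r₀) p ≡ dot r p
    [r⊕r₀]p = trans (dot-distribʳ-⊕ r r₀ p) (trans (cong (dot r p xor_) r₀p) (xor-identityʳ (dot r p)))

  -- Translating rows by the separating functional preserves their values on ps and flips the value at v.
  rowCount-halves : ∀ {n} {ps : List (F₂^ n)} {v} c → Separated ps v → 2 * rowCount c (v ∷ ps) ≡ rowCount c ps
  rowCount-halves {n} {ps} {v} c (r₀ , r₀⊥ps , r₀v) = begin
    2 * rowCount c (v ∷ ps)
      ≡⟨ cong (rowCount c (v ∷ ps) +_) (+-identityʳ (rowCount c (v ∷ ps))) ⟩
    rowCount c (v ∷ ps) + rowCount c (v ∷ ps)
      ≡⟨ cong (rowCount c (v ∷ ps) +_) (sym (∑-vectors-translate r₀ _)) ⟩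
    rowCount c (v ∷ ps) + ∑[ r ∈ vectors n ] 𝟙[ rowSolves (r ⊕ r₀) c (v ∷ ps) ]
      ≡⟨ cong (rowCount c (v ∷ ps) +_) (∑-cong (vectors n) λ r →
           cong 𝟙[_] (cong₂ (λ b a → does (b ≟ᵇ c) ∧ a) ([r⊕r₀]v r) (rowSolves-⊕ r r₀ c r₀⊥ps))) ⟩
    rowCount c (v ∷ ps) + ∑[ r ∈ vectors n ] 𝟙[ does (not (dot r v) ≟ᵇ c) ∧ rowSolves r c ps ]
      ≡⟨ sym (∑-distrib-+ (vectors n) _ _) ⟩
    ∑[ r ∈ vectors n ] (𝟙[ rowSolves r c (v ∷ ps) ] + 𝟙[ does (not (dot r v) ≟ᵇ c) ∧ rowSolves r c ps ])
      ≡⟨ ∑-cong (vectors n) (λ r → 𝟙-split-≟ (dot r v) c (rowSolves r c ps)) ⟩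
    rowCount c ps ∎
    where
    open ≡-Reasoning
    [r⊕r₀]v : ∀ r → dot (r ⊕ r₀) v ≡ not (dot r v)
    [r⊕r₀]v r = begin
      dot (r ⊕ r₀) v         ≡⟨ dot-distribʳ-⊕ r r₀ v ⟩
      dot r v xor dot r₀ v   ≡⟨ cong (dot r v xor_) r₀v ⟩
      dot r v xor true       ≡⟨ xor-comm (dot r v) true ⟩
      true xor dot r v       ≡⟨ true-xor (dot r v) ⟩
      not (dot r v)          ∎

  all-∧ : ∀ {A : Set} (f g : A → Bool) xs → all (λ x → f x ∧ g x) xs ≡ all f xs ∧ all g xs
  all-∧ f g []       = refl
  all-∧ f g (x ∷ xs) =
    trans (cong ((f x ∧ g x) ∧_) (all-∧ f g xs)) (∧-interchange (f x) (g x) (all f xs) (all g xs))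

  solves : ∀ {n m} → LinMap n m → F₂^ m → List (F₂^ n) → Bool
  solves B y ps = all (λ p → does (apply B p ≟ᵥ y)) ps

  fiberCount : ∀ {n m} → F₂^ m → List (F₂^ n) → ℕ
  fiberCount {n} {m} y ps = ∑[ B ∈ allLinMaps n m ] 𝟙[ solves B y ps ]

  fiberCount-∷ : ∀ {n m} c (y : F₂^ m) (ps : List (F₂^ n)) →
                 fiberCount (c ∷ y) ps ≡ rowCount c ps * fiberCount y ps
  fiberCount-∷ {n} {m} c y ps = begin
    fiberCount (c ∷ y) ps
      ≡⟨ ∑-allVecsOf-suc (vectors n) m _ ⟩
    ∑[ r ∈ vectors n ] ∑[ B ∈ allLinMaps n m ] 𝟙[ solves (r ∷ B) (c ∷ y) ps ]
      ≡⟨ ∑-cong (vectors n) (λ r → ∑-cong (allLinMaps n m) (λ B →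
           trans (cong 𝟙[_] (all-∧ _ _ ps)) (𝟙-∧ (rowSolves r c ps) (solves B y ps)))) ⟩
    ∑[ r ∈ vectors n ] ∑[ B ∈ allLinMaps n m ] (𝟙[ rowSolves r c ps ] * 𝟙[ solves B y ps ])
      ≡⟨ ∑-cong (vectors n) (λ r → sym (*-distribˡ-∑ 𝟙[ rowSolves r c ps ] (allLinMaps n m) _)) ⟩
    ∑[ r ∈ vectors n ] (𝟙[ rowSolves r c ps ] * fiberCount y ps)
      ≡⟨ sym (*-distribʳ-∑ (fiberCount y ps) (vectors n) _) ⟩
    rowCount c ps * fiberCount y ps ∎
    where open ≡-Reasoning

  fiberCount-separated : ∀ {n m} (y : F₂^ m) {ps : List (F₂^ n)} {v} → Separated ps v →
                         2 ^ m * fiberCount y (v ∷ ps) ≡ fiberCount y ps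
  fiberCount-separated []            sep = +-identityʳ _
  fiberCount-separated {m = suc m} (c ∷ y) {ps = ps} {v} sep = begin
    2 ^ suc m * fiberCount (c ∷ y) (v ∷ ps)
      ≡⟨ cong (2 ^ suc m *_) (fiberCount-∷ c y (v ∷ ps)) ⟩
    (2 * 2 ^ m) * (rowCount c (v ∷ ps) * fiberCount y (v ∷ ps))
      ≡⟨ *-interchange 2 (2 ^ m) (rowCount c (v ∷ ps)) (fiberCount y (v ∷ ps)) ⟩
    (2 * rowCount c (v ∷ ps)) * (2 ^ m * fiberCount y (v ∷ ps))
      ≡⟨ cong₂ _*_ (rowCount-halves c sep) (fiberCount-separated y sep) ⟩
    rowCount c ps * fiberCount y ps
      ≡⟨ sym (fiberCount-∷ c y ps) ⟩
    fiberCount (c ∷ y) ps ∎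
    where open ≡-Reasoning

  -- Fresh tuples

  module _ {n : ℕ} where

    open import Data.List.Membership.DecPropositional (_≟ᵥ_ {n}) using (_∈?_)

    fresh : List (F₂^ n) → F₂^ n → Bool
    fresh ps v = not (does (v ∈? span ps))

    fresh⇒∉ : ∀ ps v → fresh ps v ≡ true → v ∉ span ps
    fresh⇒∉ ps v isFresh v∈span with () ← trans (sym isFresh) (cong not (dec-true (v ∈? span ps) v∈span))

    fresh⇒separated : ∀ ps v → fresh ps v ≡ true → Separated ps v
    fresh⇒separated ps v isFresh = fromInj₂ (⊥-elim ∘ fresh⇒∉ ps v isFresh) (spanned-or-separated ps v)

    fresh-fiberCount : ∀ {m} (y : F₂^ m) ps v →
                       2 ^ m * (𝟙[ fresh ps v ] * fiberCount y (v ∷ ps)) ≤ fiberCount y ps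
    fresh-fiberCount {m} y ps v with fresh ps v in isFresh
    ... | true  = ≤-reflexive (trans (cong (2 ^ m *_) (*-identityˡ _))
                                     (fiberCount-separated y (fresh⇒separated ps v isFresh)))
    ... | false = subst (_≤ fiberCount y ps) (sym (*-zeroʳ (2 ^ m))) z≤n

  -- ∏_{j=1}^{t} (2^a − 2^{a−j}); the truncated subtraction is exact in the only case used, t ≤ a.
  scaledPartialγ : ℕ → ℕ → ℕ
  scaledPartialγ a zero    = 1
  scaledPartialγ a (suc t) = scaledPartialγ a t * (2 ^ a ∸ 2 ^ (a ∸ suc t))

  module _ {n m : ℕ} (u : Fin (2 ^ m) → F₂^ n) (y : F₂^ m) where

    open import Data.List.Membership.DecPropositional (_≟ᵥ_ {n}) using (_∈?_)

    indices : List (Fin (2 ^ m))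
    indices = allFin (2 ^ m)

    hits : LinMap n m → Fin (2 ^ m) → Bool
    hits B i = does (apply B (u i) ≟ᵥ y)

    freshTuples : LinMap n m → List (F₂^ n) → ℕ → ℕ
    freshTuples B ps zero    = 1
    freshTuples B ps (suc t) = ∑[ i ∈ indices ] (𝟙[ fresh ps (u i) ∧ hits B i ] * freshTuples B (u i ∷ ps) t)

    fiberTuples : List (F₂^ n) → ℕ → ℕ
    fiberTuples ps t = ∑[ B ∈ allLinMaps n m ] (𝟙[ solves B y ps ] * freshTuples B ps t)

    fiberTuples-suc : ∀ ps t →
                      fiberTuples ps (suc t) ≡ ∑[ i ∈ indices ] (𝟙[ fresh ps (u i) ] * fiberTuples (u i ∷ ps) t)
    fiberTuples-suc ps t = begin
      ∑[ B ∈ allLinMaps n m ] (𝟙[ solves B y ps ] * freshTuples B ps (suc t))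
        ≡⟨ ∑-cong (allLinMaps n m) (λ B → *-distribˡ-∑ 𝟙[ solves B y ps ] indices _) ⟩
      ∑[ B ∈ allLinMaps n m ] ∑[ i ∈ indices ] (𝟙[ solves B y ps ] * (𝟙[ fresh ps (u i) ∧ hits B i ] * next B i))
        ≡⟨ ∑-cong (allLinMaps n m) (λ B → ∑-cong indices (λ i → 𝟙-rearrange _ (fresh ps (u i)) (hits B i) _)) ⟩
      ∑[ B ∈ allLinMaps n m ] ∑[ i ∈ indices ] (𝟙[ fresh ps (u i) ] * (𝟙[ solves B y (u i ∷ ps) ] * next B i))
        ≡⟨ ∑-comm (allLinMaps n m) indices _ ⟩
      ∑[ i ∈ indices ] ∑[ B ∈ allLinMaps n m ] (𝟙[ fresh ps (u i) ] * (𝟙[ solves B y (u i ∷ ps) ] * next B i))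
        ≡⟨ ∑-cong indices (λ i → sym (*-distribˡ-∑ 𝟙[ fresh ps (u i) ] (allLinMaps n m) _)) ⟩
      ∑[ i ∈ indices ] (𝟙[ fresh ps (u i) ] * fiberTuples (u i ∷ ps) t) ∎
      where
      open ≡-Reasoning
      next : LinMap n m → Fin (2 ^ m) → ℕ
      next B i = freshTuples B (u i ∷ ps) t

    fiberTuples≤fiberCount : ∀ t ps → fiberTuples ps t ≤ fiberCount y ps
    fiberTuples≤fiberCount zero    ps =
      ≤-reflexive (∑-cong (allLinMaps n m) (λ B → *-identityʳ 𝟙[ solves B y ps ]))
    fiberTuples≤fiberCount (suc t) ps = *-cancelˡ-≤ (2 ^ m) {{m^n≢0 2 m}} (begin
      2 ^ m * fiberTuples ps (suc t)
        ≡⟨ cong (2 ^ m *_) (fiberTuples-suc ps t) ⟩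
      2 ^ m * ∑[ i ∈ indices ] (𝟙[ fresh ps (u i) ] * fiberTuples (u i ∷ ps) t)
        ≤⟨ *-monoʳ-≤ (2 ^ m) (∑-mono-≤ indices (λ i →
             *-monoʳ-≤ 𝟙[ fresh ps (u i) ] (fiberTuples≤fiberCount t (u i ∷ ps)))) ⟩
      2 ^ m * ∑[ i ∈ indices ] (𝟙[ fresh ps (u i) ] * fiberCount y (u i ∷ ps))
        ≡⟨ *-distribˡ-∑ (2 ^ m) indices _ ⟩
      ∑[ i ∈ indices ] (2 ^ m * (𝟙[ fresh ps (u i) ] * fiberCount y (u i ∷ ps)))
        ≤⟨ ∑-mono-≤ indices (λ i → fresh-fiberCount y ps (u i)) ⟩
      ∑[ i ∈ indices ] fiberCount y ps
        ≡⟨ ∑-const indices (fiberCount y ps) ⟩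
      length indices * fiberCount y ps
        ≡⟨ cong (_* fiberCount y ps) (length-tabulate {n = 2 ^ m} (λ i → i)) ⟩
      2 ^ m * fiberCount y ps ∎)
      where open ≤-Reasoning

    module _ (inj : Injective _≡_ _≡_ u) (u≢0 : ∀ i → u i ≢ zero-vec n) where

      spannedCount< : ∀ ps → suc (∑[ i ∈ indices ] 𝟙[ does (u i ∈? span ps) ]) ≤ 2 ^ length ps
      spannedCount< ps = begin
        suc (∑[ i ∈ indices ] 𝟙[ does (u i ∈? span ps) ])
          ≤⟨ s≤s (count-∈?-≤ _≟ᵥ_ (2 ^ m) u (zero-vec n) (nonemptySubsetSums ps) inj u≢0) ⟩
        length (span ps)
          ≡⟨ length-span ps ⟩
        2 ^ length ps ∎
        where open ≤-Reasoning

      module _ (a : ℕ) (B : LinMap n m) (many-hits : 2 ^ a ≤ suc (Z u y B)) where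

        freshHits≥ : ∀ ps → 2 ^ a ≤ ∑[ i ∈ indices ] 𝟙[ fresh ps (u i) ∧ hits B i ] + 2 ^ length ps
        freshHits≥ ps = begin
          2 ^ a
            ≤⟨ many-hits ⟩
          suc (Z u y B)
            ≡⟨ cong suc (length-filter≡∑ _ (indices)) ⟩
          suc (∑[ i ∈ indices ] 𝟙[ hits B i ])
            ≤⟨ s≤s (∑-mono-≤ (indices) (λ i → 𝟙-≤-split (does (u i ∈? span ps)) (hits B i))) ⟩
          suc (∑[ i ∈ indices ] (𝟙[ fresh ps (u i) ∧ hits B i ] + 𝟙[ does (u i ∈? span ps) ]))
            ≡⟨ cong suc (∑-distrib-+ (indices) _ _) ⟩
          suc (F + S)
            ≡⟨ sym (+-suc F S) ⟩
          F + suc S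
            ≤⟨ +-monoʳ-≤ F (spannedCount< ps) ⟩
          F + 2 ^ length ps ∎
          where
          open ≤-Reasoning
          F S : ℕ
          F = ∑[ i ∈ indices ] 𝟙[ fresh ps (u i) ∧ hits B i ]
          S = ∑[ i ∈ indices ] 𝟙[ does (u i ∈? span ps) ]

        freshTuples≥ : ∀ t ps → length ps + t ≤ a → scaledPartialγ a t ≤ freshTuples B ps t
        freshTuples≥ zero    ps _ = ≤-refl
        freshTuples≥ (suc t) ps room = begin
          scaledPartialγ a t * (2 ^ a ∸ 2 ^ (a ∸ suc t))
            ≤⟨ *-monoʳ-≤ (scaledPartialγ a t) enoughFresh ⟩
          scaledPartialγ a t * F
            ≡⟨ *-comm (scaledPartialγ a t) F ⟩
          F * scaledPartialγ a t
            ≡⟨ *-distribʳ-∑ (scaledPartialγ a t) (indices) _ ⟩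
          ∑[ i ∈ indices ] (𝟙[ fresh ps (u i) ∧ hits B i ] * scaledPartialγ a t)
            ≤⟨ ∑-mono-≤ (indices) (λ i → *-monoʳ-≤ 𝟙[ fresh ps (u i) ∧ hits B i ]
                 (freshTuples≥ t (u i ∷ ps) (subst (_≤ a) (+-suc (length ps) t) room))) ⟩
          freshTuples B ps (suc t) ∎
          where
          open ≤-Reasoning
          F : ℕ
          F = ∑[ i ∈ indices ] 𝟙[ fresh ps (u i) ∧ hits B i ]
          enoughFresh : 2 ^ a ∸ 2 ^ (a ∸ suc t) ≤ F
          enoughFresh = ≤-trans (∸-monoʳ-≤ (2 ^ a) (^-monoʳ-≤ 2 (m+n≤o⇒m≤o∸n (length ps) room)))
                                (m≤n+o⇒m∸n≤o (2 ^ a) (2 ^ length ps) (subst (2 ^ a ≤_) (+-comm F _) (freshHits≥ ps)))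

      countBad-bound : ∀ a → 1 ≤ a → countBad u y a * scaledPartialγ a a ≤ total n m
      countBad-bound a 1≤a = begin
        countBad u y a * scaledPartialγ a a
          ≡⟨ cong (_* scaledPartialγ a a) (length-filter≡∑ _ (allLinMaps n m)) ⟩
        ∑[ B ∈ allLinMaps n m ] 𝟙[ does (2 ^ a ∸ 2 <? Z u y B) ] * scaledPartialγ a a
          ≡⟨ *-distribʳ-∑ (scaledPartialγ a a) (allLinMaps n m) _ ⟩
        ∑[ B ∈ allLinMaps n m ] (𝟙[ does (2 ^ a ∸ 2 <? Z u y B) ] * scaledPartialγ a a)
          ≤⟨ ∑-mono-≤ (allLinMaps n m) (λ B → bad⇒manyTuples B (2 ^ a ∸ 2 <? Z u y B)) ⟩
        fiberTuples [] a
          ≤⟨ fiberTuples≤fiberCount a [] ⟩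
        fiberCount y []
          ≡⟨ ∑-const (allLinMaps n m) 1 ⟩
        length (allLinMaps n m) * 1
          ≡⟨ *-identityʳ (total n m) ⟩
        total n m ∎
        where
        open ≤-Reasoning
        bad⇒manyTuples : ∀ B → (bad? : Dec (2 ^ a ∸ 2 < Z u y B)) →
                         𝟙[ does bad? ] * scaledPartialγ a a ≤ 1 * freshTuples B [] a
        bad⇒manyTuples B (yes bad) = *-monoʳ-≤ 1 (freshTuples≥ a B many-hits a [] ≤-refl)
          where
          many-hits : 2 ^ a ≤ suc (Z u y B)
          many-hits = begin
            2 ^ a                 ≡⟨ sym (m∸n+n≡m (^-monoʳ-≤ 2 1≤a)) ⟩
            2 ^ a ∸ 2 + 2         ≡⟨ +-comm (2 ^ a ∸ 2) 2 ⟩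
            suc (suc (2 ^ a ∸ 2)) ≤⟨ s≤s bad ⟩
            suc (Z u y B)         ∎
        bad⇒manyTuples B (no _)    = z≤n

module Embedding where

  open Counting using (scaledPartialγ)

  open import Algebra.Bundles using (CommutativeRing)
  open import Data.Integer as ℤ using (+_)
  import Data.Integer.Properties as ℤP
  open import Data.Nat as ℕ using (ℕ; zero; suc; _∸_; _^_)
  import Data.Nat.Properties as ℕP
  open import Data.Nat.Coprimality using (1-coprimeTo) renaming (sym to coprime-sym)
  open import Data.Rational
  open import Data.Rational.Properties
  open import Relation.Binary.PropositionalEquality using (_≡_; refl; sym; trans; cong; cong₂; module ≡-Reasoning)

  open import Algebra.Properties.CommutativeSemigroup (CommutativeRing.*-commutativeSemigroup +-*-commutativeRing)
    using () renaming (interchange to *-interchange)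

  ι : ℕ → ℚ
  ι x = + x / 1

  ι≡mkℚ : ∀ x → ι x ≡ mkℚ (+ x) 0 (coprime-sym (1-coprimeTo x))
  ι≡mkℚ x = normalize-coprime (coprime-sym (1-coprimeTo x))

  ι-* : ∀ x y → ι (x ℕ.* y) ≡ ι x * ι y
  ι-* x y = sym (trans (cong₂ _*_ (ι≡mkℚ x) (ι≡mkℚ y)) (cong (_/ 1) (ℤP.+◃n≡+n (x ℕ.* y))))

  ι-+ : ∀ x y → ι (x ℕ.+ y) ≡ ι x + ι y
  ι-+ x y = sym (trans (cong₂ _+_ (ι≡mkℚ x) (ι≡mkℚ y))
                       (cong (_/ 1) (cong₂ ℤ._+_ (ℤP.*-identityʳ (+ x)) (ℤP.*-identityʳ (+ y)))))

  ι-mono-≤ : ∀ {x y} → x ℕ.≤ y → ι x ≤ ι y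
  ι-mono-≤ {x} {y} x≤y rewrite ι≡mkℚ x | ι≡mkℚ y =
    *≤* (ℤP.*-monoʳ-≤-nonNeg (+ 1) (ℤ.+≤+ x≤y))

  ι-∸ : ∀ x y → y ℕ.≤ x → ι (x ∸ y) ≡ ι x - ι y
  ι-∸ x y y≤x = begin
    ι (x ∸ y)                ≡⟨ sym (+-identityʳ (ι (x ∸ y))) ⟩
    ι (x ∸ y) + 0ℚ           ≡⟨ cong (λ z → ι (x ∸ y) + z) (sym (+-inverseʳ (ι y))) ⟩
    ι (x ∸ y) + (ι y - ι y)  ≡⟨ sym (+-assoc (ι (x ∸ y)) (ι y) (- ι y)) ⟩
    ι (x ∸ y) + ι y - ι y    ≡⟨ cong (_- ι y) (sym (ι-+ (x ∸ y) y)) ⟩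
    ι (x ∸ y ℕ.+ y) - ι y    ≡⟨ cong (λ z → ι z - ι y) (ℕP.m∸n+n≡m y≤x) ⟩
    ι x - ι y                ∎
    where open ≡-Reasoning

  ι-2^*half^ : ∀ j → ι (2 ^ j) * half^ j ≡ 1ℚ
  ι-2^*half^ zero    = refl
  ι-2^*half^ (suc j) = begin
    ι (2 ℕ.* 2 ^ j) * (½ * half^ j)    ≡⟨ cong (_* (½ * half^ j)) (ι-* 2 (2 ^ j)) ⟩
    ι 2 * ι (2 ^ j) * (½ * half^ j)    ≡⟨ *-interchange (ι 2) (ι (2 ^ j)) ½ (half^ j) ⟩
    ι 2 * ½ * (ι (2 ^ j) * half^ j)    ≡⟨ cong (ι 2 * ½ *_) (ι-2^*half^ j) ⟩
    1ℚ                                 ∎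
    where open ≡-Reasoning

  ι-2^-2^∸ : ∀ a j → j ℕ.≤ a → ι (2 ^ a ∸ 2 ^ (a ∸ j)) ≡ ι (2 ^ a) * (1ℚ - half^ j)
  ι-2^-2^∸ a j j≤a = begin
    ι (2 ^ a ∸ 2 ^ (a ∸ j))
      ≡⟨ ι-∸ (2 ^ a) (2 ^ (a ∸ j)) (ℕP.^-monoʳ-≤ 2 (ℕP.m∸n≤m a j)) ⟩
    ι (2 ^ a) - ι (2 ^ (a ∸ j))
      ≡⟨ cong (λ z → ι (2 ^ a) - z) (sym 2^a*half^j) ⟩
    ι (2 ^ a) - ι (2 ^ a) * half^ j
      ≡⟨ cong₂ _+_ (sym (*-identityʳ (ι (2 ^ a)))) (neg-distribʳ-* (ι (2 ^ a)) (half^ j)) ⟩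
    ι (2 ^ a) * 1ℚ + ι (2 ^ a) * (- half^ j)
      ≡⟨ sym (*-distribˡ-+ (ι (2 ^ a)) 1ℚ (- half^ j)) ⟩
    ι (2 ^ a) * (1ℚ - half^ j) ∎
    where
    open ≡-Reasoning
    2^a*half^j : ι (2 ^ a) * half^ j ≡ ι (2 ^ (a ∸ j))
    2^a*half^j = begin
      ι (2 ^ a) * half^ j                   ≡⟨ cong (λ e → ι (2 ^ e) * half^ j) (sym (ℕP.m∸n+n≡m j≤a)) ⟩
      ι (2 ^ (a ∸ j ℕ.+ j)) * half^ j       ≡⟨ cong (λ e → ι e * half^ j) (ℕP.^-distribˡ-+-* 2 (a ∸ j) j) ⟩
      ι (2 ^ (a ∸ j) ℕ.* 2 ^ j) * half^ j   ≡⟨ cong (_* half^ j) (ι-* (2 ^ (a ∸ j)) (2 ^ j)) ⟩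
      ι (2 ^ (a ∸ j)) * ι (2 ^ j) * half^ j ≡⟨ *-assoc (ι (2 ^ (a ∸ j))) (ι (2 ^ j)) (half^ j) ⟩
      ι (2 ^ (a ∸ j)) * (ι (2 ^ j) * half^ j) ≡⟨ cong (ι (2 ^ (a ∸ j)) *_) (ι-2^*half^ j) ⟩
      ι (2 ^ (a ∸ j)) * 1ℚ                  ≡⟨ *-identityʳ (ι (2 ^ (a ∸ j))) ⟩
      ι (2 ^ (a ∸ j))                       ∎

  ι-scaledPartialγ : ∀ a t → t ℕ.≤ a → ι (scaledPartialγ a t) ≡ ι ((2 ^ a) ^ t) * partialγ t
  ι-scaledPartialγ a zero    _   = sym (*-identityʳ 1ℚ)
  ι-scaledPartialγ a (suc t) t<a = begin
    ι (scaledPartialγ a t ℕ.* (2 ^ a ∸ 2 ^ (a ∸ suc t)))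
      ≡⟨ ι-* (scaledPartialγ a t) _ ⟩
    ι (scaledPartialγ a t) * ι (2 ^ a ∸ 2 ^ (a ∸ suc t))
      ≡⟨ cong₂ _*_ (ι-scaledPartialγ a t (ℕP.<⇒≤ t<a)) (ι-2^-2^∸ a (suc t) t<a) ⟩
    ι ((2 ^ a) ^ t) * partialγ t * (ι (2 ^ a) * (1ℚ - half^ (suc t)))
      ≡⟨ *-interchange (ι ((2 ^ a) ^ t)) (partialγ t) (ι (2 ^ a)) (1ℚ - half^ (suc t)) ⟩
    ι ((2 ^ a) ^ t) * ι (2 ^ a) * partialγ (suc t)
      ≡⟨ cong (_* partialγ (suc t)) (sym (ι-* ((2 ^ a) ^ t) (2 ^ a))) ⟩
    ι ((2 ^ a) ^ t ℕ.* 2 ^ a) * partialγ (suc t)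
      ≡⟨ cong (λ e → ι e * partialγ (suc t)) (ℕP.*-comm ((2 ^ a) ^ t) (2 ^ a)) ⟩
    ι ((2 ^ a) ^ suc t) * partialγ (suc t) ∎
    where open ≡-Reasoning

  ι-*-scaledPartialγ : ∀ c a → ι (c ℕ.* scaledPartialγ a a) ≡ ι (c ℕ.* 2 ^ (a ℕ.* a)) * partialγ a
  ι-*-scaledPartialγ c a = begin
    ι (c ℕ.* scaledPartialγ a a)               ≡⟨ ι-* c (scaledPartialγ a a) ⟩
    ι c * ι (scaledPartialγ a a)               ≡⟨ cong (ι c *_) (ι-scaledPartialγ a a ℕP.≤-refl) ⟩
    ι c * (ι ((2 ^ a) ^ a) * partialγ a)       ≡⟨ cong (λ e → ι c * (ι e * partialγ a)) (ℕP.^-*-assoc 2 a a) ⟩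
    ι c * (ι (2 ^ (a ℕ.* a)) * partialγ a)     ≡⟨ sym (*-assoc (ι c) (ι (2 ^ (a ℕ.* a))) (partialγ a)) ⟩
    ι c * ι (2 ^ (a ℕ.* a)) * partialγ a       ≡⟨ cong (_* partialγ a) (sym (ι-* c (2 ^ (a ℕ.* a)))) ⟩
    ι (c ℕ.* 2 ^ (a ℕ.* a)) * partialγ a       ∎
    where open ≡-Reasoning

  p≤p*[1+1/[1+k]] : ∀ x k → ι x ≤ ι x * (1ℚ + + 1 / suc k)
  p≤p*[1+1/[1+k]] x k = begin
    ι x                  ≡⟨ sym (+-identityʳ (ι x)) ⟩
    ι x + 0ℚ             ≤⟨ +-monoʳ-≤ (ι x) (nonNegative⁻¹ (ι x * q) {{nonNeg*nonNeg⇒nonNeg (ι x) q}}) ⟩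
    ι x + ι x * q        ≡⟨ cong (_+ ι x * q) (sym (*-identityʳ (ι x))) ⟩
    ι x * 1ℚ + ι x * q   ≡⟨ sym (*-distribˡ-+ (ι x) 1ℚ q) ⟩
    ι x * (1ℚ + q)       ∎
    where
    open ≤-Reasoning
    q = + 1 / suc k
    instance
      ι-nonNeg : NonNegative (ι x)
      ι-nonNeg = normalize-nonNeg x 1
      q-nonNeg : NonNegative q
      q-nonNeg = normalize-nonNeg 1 (suc k)

open import Data.Nat using (ℕ; suc; _^_; _*_; _≥_)
open import Data.Fin using (Fin)
open import Data.Product using (∃-syntax; _,_)
open import Relation.Nullary using (¬_)
open import Relation.Binary.PropositionalEquality using (_≡_)
open import Function.Definitions using (Injective)
open import Data.Integer using (+_)
open import Data.Rational using (ℚ; _≤_; _+_; 1ℚ) renaming (_*_ to _*ℚ_; _/_ to _/ℚ_)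
open import Data.Rational.Properties using (module ≤-Reasoning)
open import Relation.Binary.PropositionalEquality using (sym)
open Counting using (countBad-bound; scaledPartialγ)
open Embedding using (ι; ι-mono-≤; ι-*-scaledPartialγ; p≤p*[1+1/[1+k]])

corollary2p3 : (n m : ℕ) (u : Fin (2 ^ m) → F₂^ n) →
    Injective _≡_ _≡_ u →
    ((i : Fin (2 ^ m)) → ¬ (u i ≡ zero-vec n)) →
    (y : F₂^ m) (a : ℕ) → a ≥ 1 →
    (k : ℕ) → ∃[ N ]
      ((+ (countBad u y a * 2 ^ (a * a)) /ℚ 1) *ℚ partialγ N
        ≤ (+ total n m /ℚ 1) *ℚ (1ℚ + (+ 1 /ℚ suc k)))
-- N = a suffices, with no use of the slack 1/(k+1): partialγ a ≥ γ makes this bound the stronger one.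
corollary2p3 n m u inj u≢0 y a a≥1 k = a , (begin
  ι (countBad u y a * 2 ^ (a * a)) *ℚ partialγ a ≡⟨ sym (ι-*-scaledPartialγ (countBad u y a) a) ⟩
  ι (countBad u y a * scaledPartialγ a a)        ≤⟨ ι-mono-≤ (countBad-bound u y inj u≢0 a a≥1) ⟩
  ι (total n m)                                   ≤⟨ p≤p*[1+1/[1+k]] (total n m) k ⟩
  ι (total n m) *ℚ (1ℚ + + 1 /ℚ suc k)            ∎)
  where open ≤-Reasoning
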